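{- Let $A$ be a finite non-empty alphabet. Let $\lambda$ be a left-infinite word and $\rho$ a right-infinite word over $A$, both ultimately periodic and having the same set of period words, with canonical forms $\lambda={}^{\omega}u\,w_1$ and $\rho=w_2\,v^{\omega}$. Write $u=yz$ and $v=zy$ with $z\in A^*$, $y\in A^+$ (so $p:=|u|=|v|\geq 1$), and assume $|w_1|\geq|w_2|$. Put $m'=|w_2|$, $m=|w_1|$, $M=m+p-1$. Let $\overline m$ be the unique integer in $\{M,M+1,\dots,M+p-1\}$ with $\overline m\equiv m'+|z|\pmod p$, let $d\ge 0$ be the integer with $\overline m=m'+|z|+dp$, and let $k_0$ be the least positive integer such that $|z|+(d+k_0)p>M$. Then for all integers $k\geq k_0$ and $j\in\{0,1,\dots,p-1\}$, $$rog(\lambda_{n},\rho_{n})=M-j\quad\text{where } n=\overline m+1+j+pk.$$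
   Context: $A^*$ is the free monoid of finite words (including the empty word) and $A^+$ the non-empty words; $\mathbb{N}=\{0,1,2,\dots\}$. A left-infinite word is a sequence $\cdots a_{ -2}a_{ -1}a_0$ indexed by $-\mathbb{N}$; a right-infinite word is a sequence $a_0a_1\cdots$ indexed by $\mathbb{N}$. For $u\in A^+$, $w\in A^*$, ${}^{\omega}u\,w=\cdots uuuw$ and $w\,u^{\omega}=wuuu\cdots$. A left-infinite (resp. right-infinite) word is ultimately periodic if it equals ${}^{\omega}u\,w$ (resp. $w\,u^{\omega}$) for some $u\in A^+$, $w\in A^*$; such $u$ is called a period word. For an ultimately periodic word there are unique words $u,w$ of shortest length with $\lambda={}^{\omega}u\,w$ (resp. $\rho=w\,u^{\omega}$); this is its canonical form (then $u$ is primitive, and if $w\neq\varepsilon$ the first letters (for $\lambda$), resp. the last letters (for $\rho$), of $u$ and $w$ differ). For $n\in\mathbb{N}$, $\lambda_n$ is the suffix of length $n$ of $\lambda$ and $\rho_n$ the prefix of length $n$ of $\rho$. For finite words $s,t$ of equal length, $rog(s,t)=\min\{n\in\mathbb{N}: xs=tx' \text{ for some } x,x'\in A^n\}$. -}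

module Defs where

open import Data.Nat using (ℕ; zero; suc; _≤_)
open import Data.List using (List; []; _∷_; _++_; length; reverse)
open import Data.Product using (Σ; ∃; _×_; _,_)
open import Relation.Binary.PropositionalEquality using (_≡_)
open import Relation.Nullary using (¬_)

-- Infinite words are functions ℕ → A.
-- A right-infinite word ρ = a₀a₁a₂⋯ is the function i ↦ aᵢ.
-- A left-infinite word λ = ⋯a₋₂a₋₁a₀ is the function i ↦ a₋ᵢ
-- (index 0 is the LAST letter).

module _ {A : Set} where

  -- (a ∷ as)^ω read from position i, where `rest` is the remainder
  -- of the current copy still to be read (after its first letter was used).
  cyc : A → List A → List A → ℕ → A
  cyc a as [] zero = a
  cyc a as [] (suc i) = cyc a as as i
  cyc a as (b ∷ bs) zero = b
  cyc a as (b ∷ bs) (suc i) = cyc a as bs i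

  rightWord : List A → A → List A → ℕ → A
  rightWord (c ∷ cs) a as zero = c
  rightWord (c ∷ cs) a as (suc i) = rightWord cs a as i
  rightWord [] a as i = cyc a as [] i

  RightUP : (ℕ → A) → List A → List A → Set
  RightUP ρ w u = Σ A λ a → Σ (List A) λ as →
    (u ≡ a ∷ as) × (∀ i → ρ i ≡ rightWord w a as i)

  -- λ = ^ω u w  (u non-empty).  Reading λ from its end leftwards gives the
  -- right-infinite word  (reverse w) (reverse u)^ω.
  LeftUP : (ℕ → A) → List A → List A → Set
  LeftUP λw u w = Σ A λ a → Σ (List A) λ as →
    (reverse u ≡ a ∷ as) × (∀ i → λw i ≡ rightWord (reverse w) a as i)

  CanonicalL : (ℕ → A) → List A → List A → Set
  CanonicalL λw u w = LeftUP λw u w ×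
    (∀ u' w' → LeftUP λw u' w' → (length u ≤ length u') × (length w ≤ length w'))

  CanonicalR : (ℕ → A) → List A → List A → Set
  CanonicalR ρ w v = RightUP ρ w v ×
    (∀ w' v' → RightUP ρ w' v' → (length v ≤ length v') × (length w ≤ length w'))

  SamePeriodWords : (ℕ → A) → (ℕ → A) → Set
  SamePeriodWords λw ρ = ∀ u →
    ((∃ λ w → LeftUP λw u w) → (∃ λ w → RightUP ρ w u)) ×
    ((∃ λ w → RightUP ρ w u) → (∃ λ w → LeftUP λw u w))

  suffixL : (ℕ → A) → ℕ → List A
  suffixL λw zero = []
  suffixL λw (suc n) = suffixL (λ i → λw (suc i)) n ++ (λw 0 ∷ [])

  prefixR : (ℕ → A) → ℕ → List A
  prefixR ρ zero = []
  prefixR ρ (suc n) = ρ 0 ∷ prefixR (λ i → ρ (suc i)) n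

  Overlap : List A → List A → ℕ → Set
  Overlap s t n = Σ (List A) λ x → Σ (List A) λ x' →
    (length x ≡ n) × (length x' ≡ n) × (x ++ s ≡ t ++ x')

  IsRog : List A → List A → ℕ → Set
  IsRog s t r = Overlap s t r × (∀ n → Overlap s t n → r ≤ n)

-- Index λ from its right end and ρ from its left end. Overlapping λₙ and ρₙ at offset r then says
-- λ a = ρ b whenever a, b ≥ r and a + b + 1 = n + r. Beyond w₁ and w₂ both words are periodic: λ read
-- leftwards repeats the reverse of u, ρ repeats v = zy, a rotation of u = yz. So all letters
-- a ≥ m, b ≥ m' with a + b + 1 ≡ m + m' + |z| (mod p) match, and r₀ = M − j ≥ m ≥ m' is an offset
-- on such an antidiagonal: λₙ and ρₙ overlap at r₀. An overlap at some r < r₀ would give a second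
-- matching antidiagonal, shifted by δ = r₀ − r; where both apply (a window of length p, as n is
-- large) δ is a period of u^ω, so p ∣ δ because u is primitive. Then r < m, and the first letter
-- of w₁ would equal the letter p positions to its left, contradicting the canonicity of w₁.

module Submission where

open import Defs
open import Data.Nat
open import Data.Nat.Properties
open import Data.Nat.DivMod using (_%_; _/_; m≡m%n+[m/n]*n; m%n<n)
open import Data.Nat.Divisibility using (_∣_; divides; m%n≡0⇒n∣m)
open import Data.Nat.Tactic.RingSolver using (solve-∀)
open import Data.Fin using (Fin)
open import Data.List using (List; []; _∷_; _++_; _∷ʳ_; length; reverse; take; drop)
open import Data.List.Properties
  using ( length-++; length-reverse; unfold-reverse; reverse-involutive; length-take; take++drop≡id
        ; ++-assoc; ++-identityʳ; ∷-injective; ∷ʳ-injective )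
open import Data.Product using (∃; ∃₂; _×_; _,_; proj₁; proj₂)
open import Data.Empty using (⊥; ⊥-elim)
open import Relation.Nullary using (¬_; yes; no)
open import Relation.Binary.PropositionalEquality

module _ {A : Set} where

  prepend : List A → (ℕ → A) → ℕ → A
  prepend []       f i       = f i
  prepend (c ∷ cs) f zero    = c
  prepend (c ∷ cs) f (suc i) = prepend cs f i

  prepend-+ : ∀ ℓ f i → prepend ℓ f (length ℓ + i) ≡ f i
  prepend-+ []      f i = refl
  prepend-+ (c ∷ ℓ) f i = prepend-+ ℓ f i

  prepend-< : ∀ ℓ f g {i} → i < length ℓ → prepend ℓ f i ≡ prepend ℓ g i
  prepend-< (c ∷ ℓ) f g {zero}  _         = refl
  prepend-< (c ∷ ℓ) f g {suc i} (s≤s i<ℓ) = prepend-< ℓ f g i<ℓ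

  prepend-++ : ∀ ℓ₁ ℓ₂ f → prepend (ℓ₁ ++ ℓ₂) f ≗ prepend ℓ₁ (prepend ℓ₂ f)
  prepend-++ []       ℓ₂ f i       = refl
  prepend-++ (c ∷ ℓ₁) ℓ₂ f zero    = refl
  prepend-++ (c ∷ ℓ₁) ℓ₂ f (suc i) = prepend-++ ℓ₁ ℓ₂ f i

  prepend-cong : ∀ ℓ {f g} → f ≗ g → prepend ℓ f ≗ prepend ℓ g
  prepend-cong []      f≗g i       = f≗g i
  prepend-cong (c ∷ ℓ) f≗g zero    = refl
  prepend-cong (c ∷ ℓ) f≗g (suc i) = prepend-cong ℓ f≗g i

  prepend-snoc : ∀ ℓ c f → prepend (ℓ ∷ʳ c) f (length ℓ) ≡ c
  prepend-snoc []      c f = refl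
  prepend-snoc (x ∷ ℓ) c f = prepend-snoc ℓ c f

  prepend-reverse-∷ : ∀ c ℓ f → prepend (reverse (c ∷ ℓ)) f ≗ prepend (reverse ℓ) (prepend (c ∷ []) f)
  prepend-reverse-∷ c ℓ f i rewrite unfold-reverse c ℓ = prepend-++ (reverse ℓ) (c ∷ []) f i

  prepend-reverse-last : ∀ c ℓ f → prepend (reverse (c ∷ ℓ)) f (length ℓ) ≡ c
  prepend-reverse-last c ℓ f rewrite unfold-reverse c ℓ =
    subst (λ i → prepend (reverse ℓ ∷ʳ c) f i ≡ c) (length-reverse ℓ) (prepend-snoc (reverse ℓ) c f)

  prepend-reverse : ∀ ℓ f g {i k} → suc (i + k) ≡ length ℓ → prepend (reverse ℓ) f i ≡ prepend ℓ g k
  prepend-reverse (c ∷ ℓ) f g {i} {zero} e =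
    subst (λ j → prepend (reverse (c ∷ ℓ)) f j ≡ c)
          (sym (trans (sym (+-identityʳ i)) (suc-injective e)))
          (prepend-reverse-last c ℓ f)
  prepend-reverse (c ∷ ℓ) f g {i} {suc k} e =
    trans (prepend-reverse-∷ c ℓ f i)
          (prepend-reverse ℓ _ g (suc-injective (trans (cong suc (sym (+-suc i k))) e)))

  Period : ℕ → (ℕ → A) → Set
  Period p f = ∀ i → f (p + i) ≡ f i

  period-* : ∀ {p f} → Period p f → ∀ q i → f (q * p + i) ≡ f i
  period-*         per zero    i = refl
  period-* {p} {f} per (suc q) i = trans (cong f (+-assoc p (q * p) i)) (trans (per _) (period-* per q i))

  period-shift : ∀ {p f} δ → Period p f → Period p (λ i → f (δ + i))
  period-shift {p} {f} δ per i = trans (cong f (x+[y+z]≡y+[x+z] δ p i)) (per (δ + i))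
    where x+[y+z]≡y+[x+z] : ∀ x y z → x + (y + z) ≡ y + (x + z)
          x+[y+z]≡y+[x+z] = solve-∀

  period-% : ∀ {p δ f} .{{_ : NonZero p}} → Period p f → Period δ f → Period (δ % p) f
  period-% {p} {δ} {f} per-p per-δ i = begin
    f (δ % p + i)                 ≡⟨ period-* per-p (δ / p) _ ⟨
    f (δ / p * p + (δ % p + i))   ≡⟨ cong f (trans (x+[y+z]≡y+x+z (δ / p * p) (δ % p) i)
                                                  (cong (_+ i) (sym (m≡m%n+[m/n]*n δ p)))) ⟩
    f (δ + i)                     ≡⟨ per-δ i ⟩
    f i                           ∎
    where open ≡-Reasoning
          x+[y+z]≡y+x+z : ∀ x y z → x + (y + z) ≡ y + x + z
          x+[y+z]≡y+x+z = solve-∀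

  period-residue : ∀ {p f} .{{_ : NonZero p}} → Period p f → ∀ a i → f i ≡ f (a + (a * p ∸ a + i) % p)
  period-residue {p} {f} per a i = begin
    f i                            ≡⟨ period-* per a i ⟨
    f (a * p + i)                  ≡⟨ cong f (sym a+e≡ap+i) ⟩
    f (a + e)                      ≡⟨ cong f (trans (cong (a +_) (m≡m%n+[m/n]*n e p)) (x+[y+z]≡z+[x+y] a (e % p) _)) ⟩
    f (e / p * p + (a + e % p))    ≡⟨ period-* per (e / p) _ ⟩
    f (a + e % p)                  ∎
    where open ≡-Reasoning
          e = a * p ∸ a + i
          a+e≡ap+i : a + e ≡ a * p + i
          a+e≡ap+i = trans (sym (+-assoc a (a * p ∸ a) i)) (cong (_+ i) (m+[n∸m]≡n (m≤m*n a p)))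
          x+[y+z]≡z+[x+y] : ∀ x y z → x + (y + z) ≡ z + (x + y)
          x+[y+z]≡z+[x+y] = solve-∀

  period-window : ∀ {p f g} .{{_ : NonZero p}} → Period p f → Period p g →
                  ∀ a → (∀ i → i < p → f (a + i) ≡ g (a + i)) → f ≗ g
  period-window {p} per-f per-g a window i =
    trans (period-residue per-f a i)
          (trans (window _ (m%n<n (a * p ∸ a + i) p)) (sym (period-residue per-g a i)))

  IsOmegaPower : List A → (ℕ → A) → Set
  IsOmegaPower ℓ f = f ≗ prepend ℓ f

  cyc-prepend : ∀ a as bs → cyc a as bs ≗ prepend bs (cyc a as [])
  cyc-prepend a as []       i       = refl
  cyc-prepend a as (b ∷ bs) zero    = refl
  cyc-prepend a as (b ∷ bs) (suc i) = cyc-prepend a as bs i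

  cyc-omegaPower : ∀ a as → IsOmegaPower (a ∷ as) (cyc a as [])
  cyc-omegaPower a as zero    = refl
  cyc-omegaPower a as (suc i) = cyc-prepend a as as i

  omegaPower-cyc : ∀ {ℓ a as} → ℓ ≡ a ∷ as → IsOmegaPower ℓ (cyc a as [])
  omegaPower-cyc refl = cyc-omegaPower _ _

  rightWord-prepend : ∀ w a as → rightWord w a as ≗ prepend w (cyc a as [])
  rightWord-prepend []      a as i       = refl
  rightWord-prepend (c ∷ w) a as zero    = refl
  rightWord-prepend (c ∷ w) a as (suc i) = rightWord-prepend w a as i

  omegaPower-period : ∀ {ℓ f} → IsOmegaPower ℓ f → Period (length ℓ) f
  omegaPower-period {ℓ} {f} pw i = trans (pw _) (prepend-+ ℓ f i)

  omegaPower-unique : ∀ {a as f g} → IsOmegaPower (a ∷ as) f → IsOmegaPower (a ∷ as) g → f ≗ g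
  omegaPower-unique {a} {as} {f} {g} pw-f pw-g =
    period-window (omegaPower-period pw-f) (omegaPower-period pw-g) 0
      (λ i i<p → trans (pw-f i) (trans (prepend-< (a ∷ as) f g i<p) (sym (pw-g i))))

  omegaPower-rotate : ∀ {ℓ₁ ℓ₂ f} → IsOmegaPower (ℓ₁ ++ ℓ₂) f → IsOmegaPower (ℓ₂ ++ ℓ₁) (prepend ℓ₂ f)
  omegaPower-rotate {ℓ₁} {ℓ₂} {f} pw i =
    trans (prepend-cong ℓ₂ (λ j → trans (pw j) (prepend-++ ℓ₁ ℓ₂ f j)) i)
          (sym (prepend-++ ℓ₂ ℓ₁ (prepend ℓ₂ f) i))

  length-take-≤ : ∀ {c} (ℓ : List A) → c ≤ length ℓ → length (take c ℓ) ≡ c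
  length-take-≤ {c} ℓ c≤ℓ = trans (length-take c ℓ) (m≤n⇒m⊓n≡m c≤ℓ)

  omegaPower-take : ∀ {ℓ f c} → IsOmegaPower ℓ f → Period c f → c ≤ length ℓ → IsOmegaPower (take c ℓ) f
  omegaPower-take {ℓ} {f} {c} pw per c≤ℓ i with i <? c
  ... | yes i<c = begin
    f i                                             ≡⟨ pw i ⟩
    prepend ℓ f i                                   ≡⟨ cong (λ ℓ' → prepend ℓ' f i) (sym (take++drop≡id c ℓ)) ⟩
    prepend (take c ℓ ++ drop c ℓ) f i              ≡⟨ prepend-++ (take c ℓ) (drop c ℓ) f i ⟩
    prepend (take c ℓ) (prepend (drop c ℓ) f) i     ≡⟨ prepend-< (take c ℓ) _ f
                                                           (subst (i <_) (sym (length-take-≤ ℓ c≤ℓ)) i<c) ⟩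
    prepend (take c ℓ) f i                          ∎
    where open ≡-Reasoning
  ... | no i≮c with m≤n⇒∃[o]m+o≡n (≮⇒≥ i≮c)
  ...   | i' , refl = trans (per i') (sym (subst (λ j → prepend (take c ℓ) f (j + i') ≡ f i')
                                                  (length-take-≤ ℓ c≤ℓ) (prepend-+ (take c ℓ) f i')))

  omegaPower-reverse-mirror : ∀ ℓ {f g} → IsOmegaPower (reverse ℓ) f → IsOmegaPower ℓ g →
                              ∀ t {i k} → suc (i + k) ≡ t * length ℓ → f i ≡ g k
  omegaPower-reverse-mirror ℓ {f} {g} pw-f pw-g (suc t) {i} {k} e with length ℓ ≤? i | length ℓ ≤? k
  ... | yes p≤i | _ with m≤n⇒∃[o]m+o≡n p≤i
  ...   | i' , refl = trans (per-f i') (omegaPower-reverse-mirror ℓ pw-f pw-g t (+-cancelˡ-≡ (length ℓ) _ _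
                        (trans (+-suc (length ℓ) (i' + k)) (trans (cong suc (sym (+-assoc (length ℓ) i' k))) e))))
    where per-f : Period (length ℓ) f
          per-f = subst (λ p → Period p f) (length-reverse ℓ) (omegaPower-period {reverse ℓ} pw-f)
  omegaPower-reverse-mirror ℓ {f} {g} pw-f pw-g (suc t) {i} {k} e | no _ | yes p≤k with m≤n⇒∃[o]m+o≡n p≤k
  ...   | k' , refl = trans (omegaPower-reverse-mirror ℓ pw-f pw-g t (+-cancelˡ-≡ (length ℓ) _ _
                        (trans (x+suc[y+z]≡suc[y+[x+z]] (length ℓ) i k') e))) (sym (omegaPower-period {ℓ} pw-g k'))
    where x+suc[y+z]≡suc[y+[x+z]] : ∀ x y z → x + suc (y + z) ≡ suc (y + (x + z))
          x+suc[y+z]≡suc[y+[x+z]] = solve-∀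
  omegaPower-reverse-mirror ℓ {f} {g} pw-f pw-g (suc t) {i} {k} e | no p≰i | no p≰k with t
  ...   | zero = trans (pw-f i) (trans (prepend-reverse ℓ f g (trans e (+-identityʳ _))) (sym (pw-g k)))
  ...   | suc t' = ⊥-elim (<⇒≢ i+k<2p e)
    where i+k<2p : suc (i + k) < length ℓ + (length ℓ + t' * length ℓ)
          i+k<2p = ≤-trans (≤-reflexive (cong suc (sym (+-suc i k))))
                     (≤-trans (+-mono-≤ (≰⇒> p≰i) (≰⇒> p≰k)) (+-monoʳ-≤ (length ℓ) (m≤m+n (length ℓ) _)))

  length-prefixR : ∀ (f : ℕ → A) n → length (prefixR f n) ≡ n
  length-prefixR f zero    = refl
  length-prefixR f (suc n) = cong suc (length-prefixR _ n)

  length-suffixL : ∀ (f : ℕ → A) n → length (suffixL f n) ≡ n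
  length-suffixL f zero    = refl
  length-suffixL f (suc n) = trans (length-++ (suffixL _ n)) (trans (+-comm _ 1) (cong suc (length-suffixL _ n)))

  prefixR-+ : ∀ (f : ℕ → A) r L → prefixR f (r + L) ≡ prefixR f r ++ prefixR (λ i → f (r + i)) L
  prefixR-+ f zero    L = refl
  prefixR-+ f (suc r) L = cong (f 0 ∷_) (prefixR-+ (λ i → f (suc i)) r L)

  suffixL-+ : ∀ (f : ℕ → A) r L → suffixL f (r + L) ≡ suffixL (λ i → f (r + i)) L ++ suffixL f r
  suffixL-+ f zero    L = sym (++-identityʳ _)
  suffixL-+ f (suc r) L = trans (cong (_++ (f 0 ∷ [])) (suffixL-+ (λ i → f (suc i)) r L))
                                (++-assoc (suffixL (λ i → f (suc (r + i))) L) _ _)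

  prefixR-snoc : ∀ (f : ℕ → A) L → prefixR f (suc L) ≡ prefixR f L ∷ʳ f L
  prefixR-snoc f zero    = refl
  prefixR-snoc f (suc L) = cong (f 0 ∷_) (prefixR-snoc (λ i → f (suc i)) L)

  mirror⇒suffixL≡prefixR : ∀ (f g : ℕ → A) L → (∀ x y → suc (x + y) ≡ L → f x ≡ g y) → suffixL f L ≡ prefixR g L
  mirror⇒suffixL≡prefixR f g zero    h = refl
  mirror⇒suffixL≡prefixR f g (suc L) h =
    trans (cong₂ _++_ (mirror⇒suffixL≡prefixR (λ i → f (suc i)) g L (λ x y e → h (suc x) y (cong suc e)))
                      (cong (_∷ []) (h 0 L refl)))
          (sym (prefixR-snoc g L))

  suffixL≡prefixR⇒mirror : ∀ (f g : ℕ → A) L → suffixL f L ≡ prefixR g L → ∀ x y → suc (x + y) ≡ L → f x ≡ g y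
  suffixL≡prefixR⇒mirror f g (suc L) eq x y e
    with ∷ʳ-injective (suffixL (λ i → f (suc i)) L) (prefixR g L) (trans eq (prefixR-snoc g L))
  suffixL≡prefixR⇒mirror f g (suc L) eq zero    y e | _ , f0≡gL = trans f0≡gL (cong g (suc-injective (sym e)))
  suffixL≡prefixR⇒mirror f g (suc L) eq (suc x) y e | init≡ , _ =
    suffixL≡prefixR⇒mirror (λ i → f (suc i)) g L init≡ x y (suc-injective e)

  ++-injective : ∀ {a b c d : List A} → length a ≡ length c → a ++ b ≡ c ++ d → a ≡ c × b ≡ d
  ++-injective {[]}    {c = []}     _ e = refl , e
  ++-injective {x ∷ a} {c = x' ∷ c} l e with ∷-injective e
  ... | refl , e' with ++-injective {a} {c = c} (suc-injective l) e'
  ...   | refl , b≡d = refl , b≡d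

  overlap-++⇒ : ∀ (S₁ S₂ T₁ T₂ : List A) {r} → length T₁ ≡ r → length S₁ ≡ length T₂ →
                Overlap (S₁ ++ S₂) (T₁ ++ T₂) r → S₁ ≡ T₂
  overlap-++⇒ S₁ S₂ T₁ T₂ |T₁| |S₁| (x , x' , |x| , _ , e) =
    proj₁ (++-injective {S₁} {S₂} {T₂} |S₁|
            (proj₂ (++-injective {x} {c = T₁} (trans |x| (sym |T₁|)) (trans e (++-assoc T₁ T₂ x')))))

  overlap-++⇐ : ∀ (S₁ S₂ T₁ T₂ : List A) {r} → length T₁ ≡ r → length S₂ ≡ r → S₁ ≡ T₂ →
                Overlap (S₁ ++ S₂) (T₁ ++ T₂) r
  overlap-++⇐ S₁ S₂ T₁ T₂ |T₁| |S₂| refl = T₁ , S₂ , |T₁| , |S₂| , sym (++-assoc T₁ S₁ S₂)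

  Mirror : (ℕ → A) → (ℕ → A) → ℕ → ℕ → ℕ → Set
  Mirror f g a₀ b₀ s = ∀ a b → a₀ ≤ a → b₀ ≤ b → suc (a + b) ≡ s → f a ≡ g b

  mirror-mono : ∀ {f g a₀ b₀ a₁ b₁ s} → a₀ ≤ a₁ → b₀ ≤ b₁ → Mirror f g a₀ b₀ s → Mirror f g a₁ b₁ s
  mirror-mono a₀≤a₁ b₀≤b₁ mir a b a₁≤a b₁≤b = mir a b (≤-trans a₀≤a₁ a₁≤a) (≤-trans b₀≤b₁ b₁≤b)

  private
    mirror-sum : ∀ r x y → suc (r + x + (r + y)) ≡ r + suc (x + y) + r
    mirror-sum = solve-∀

  overlap⇒mirror : ∀ (f g : ℕ → A) {r n} → r ≤ n → Overlap (suffixL f n) (prefixR g n) r → Mirror f g r r (n + r)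
  overlap⇒mirror f g {r} r≤n ov with m≤n⇒∃[o]m+o≡n r≤n
  ... | L , refl = shifted
    where
      suffix≡prefix : suffixL (λ i → f (r + i)) L ≡ prefixR (λ i → g (r + i)) L
      suffix≡prefix = overlap-++⇒ _ (suffixL f r) (prefixR g r) _ (length-prefixR g r)
        (trans (length-suffixL _ L) (sym (length-prefixR _ L)))
        (subst₂ (λ s t → Overlap s t r) (suffixL-+ f r L) (prefixR-+ g r L) ov)
      shifted : Mirror f g r r (r + L + r)
      shifted a b r≤a r≤b e with m≤n⇒∃[o]m+o≡n r≤a | m≤n⇒∃[o]m+o≡n r≤b
      ... | x , refl | y , refl = suffixL≡prefixR⇒mirror _ _ L suffix≡prefix x y
        (+-cancelˡ-≡ r _ _ (+-cancelʳ-≡ r _ _ (trans (sym (mirror-sum r x y)) e)))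

  mirror⇒overlap : ∀ (f g : ℕ → A) {r n} → r ≤ n → Mirror f g r r (n + r) → Overlap (suffixL f n) (prefixR g n) r
  mirror⇒overlap f g {r} r≤n mir with m≤n⇒∃[o]m+o≡n r≤n
  ... | L , refl = subst₂ (λ s t → Overlap s t r) (sym (suffixL-+ f r L)) (sym (prefixR-+ g r L))
    (overlap-++⇐ (suffixL (λ i → f (r + i)) L) (suffixL f r) (prefixR g r) (prefixR (λ i → g (r + i)) L)
      (length-prefixR g r) (length-suffixL f r)
      (mirror⇒suffixL≡prefixR _ _ L λ x y e →
        mir (r + x) (r + y) (m≤m+n r x) (m≤m+n r y) (trans (mirror-sum r x y) (cong (λ t → r + t + r) e))))

  ∷-of-length : ∀ (xs : List A) {n} → length xs ≡ suc n → ∃₂ λ x xs' → xs ≡ x ∷ xs' × length xs' ≡ n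
  ∷-of-length (x ∷ xs') e = x , xs' , refl , suc-injective e

  omegaPower-shorter : ∀ {ℓ f c} → IsOmegaPower ℓ f → Period (suc c) f → suc c ≤ length ℓ →
                       ∃₂ λ a as → IsOmegaPower (a ∷ as) f × length as ≡ c
  omegaPower-shorter {b ∷ bs} pw per (s≤s c≤bs) = b , take _ bs , omegaPower-take pw per (s≤s c≤bs) , length-take-≤ bs c≤bs

  leftUP-omegaPower : ∀ {λw : ℕ → A} {w a as f} → λw ≗ prepend (reverse w) f → IsOmegaPower (a ∷ as) f →
                      LeftUP λw (reverse (a ∷ as)) w
  leftUP-omegaPower {w = w} {a} {as} λw≗ pw = a , as , reverse-involutive (a ∷ as) , λ i →
    trans (λw≗ i) (trans (prepend-cong (reverse w) (omegaPower-unique pw (cyc-omegaPower a as)) i)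
                         (sym (rightWord-prepend (reverse w) a as i)))

  -- ^ω(cu·ut)·cw·wt = ^ω(ut·cu)·wt as soon as cw = cu.
  leftUP-absorb-first-letter : ∀ {λw : ℕ → A} {cw wt cu ut f} → λw ≗ prepend (reverse (cw ∷ wt)) f →
    IsOmegaPower (reverse (cu ∷ ut)) f → λw (length wt) ≡ f (length ut) → ∃ λ u' → LeftUP λw u' wt
  leftUP-absorb-first-letter {λw} {cw} {wt} {cu} {ut} {f} λw≗ pw first≡ =
    reverse (cu ∷ reverse ut) , leftUP-omegaPower {w = wt} λw≗′ pw′
    where
      cw≡cu : cw ≡ cu
      cw≡cu = trans (sym (trans (λw≗ _) (prepend-reverse-last cw wt f)))
                    (trans first≡ (trans (pw _) (prepend-reverse-last cu ut f)))
      λw≗′ : λw ≗ prepend (reverse wt) (prepend (cu ∷ []) f)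
      λw≗′ i = trans (λw≗ i) (trans (prepend-reverse-∷ cw wt f i)
                                    (cong (λ c → prepend (reverse wt) (prepend (c ∷ []) f) i) cw≡cu))
      pw′ : IsOmegaPower (cu ∷ reverse ut) (prepend (cu ∷ []) f)
      pw′ = omegaPower-rotate {ℓ₁ = reverse ut} {cu ∷ []}
              (λ i → trans (pw i) (cong (λ ℓ → prepend ℓ f i) (unfold-reverse cu ut)))

module CanonicalLeft {A : Set} {λw : ℕ → A} {u w : List A} {P : ℕ → A}
  (P-power : IsOmegaPower (reverse u) P) (λw≗ : λw ≗ prepend (reverse w) P)
  (minimal : ∀ u' w' → LeftUP λw u' w' → length u ≤ length u' × length w ≤ length w')
  where

  λw-tail : ∀ i → λw (length w + i) ≡ P i
  λw-tail i = trans (λw≗ _) (subst (λ m → prepend (reverse w) P (m + i) ≡ P i) (length-reverse w)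
                                   (prepend-+ (reverse w) P i))

  P-period : Period (length u) P
  P-period = subst (λ p → Period p P) (length-reverse u) (omegaPower-period {ℓ = reverse u} P-power)

  λw-period : ∀ q {i} → length w ≤ i → λw (q * length u + i) ≡ λw i
  λw-period q w≤i with m≤n⇒∃[o]m+o≡n w≤i
  ... | j , refl = begin
    λw (q * length u + (length w + j))  ≡⟨ cong λw (x+[y+z]≡y+[x+z] (q * length u) (length w) j) ⟩
    λw (length w + (q * length u + j))  ≡⟨ λw-tail _ ⟩
    P (q * length u + j)                ≡⟨ period-* P-period q j ⟩
    P j                                 ≡⟨ λw-tail j ⟨
    λw (length w + j)                   ∎
    where open ≡-Reasoning
          x+[y+z]≡y+[x+z] : ∀ x y z → x + (y + z) ≡ y + (x + z)
          x+[y+z]≡y+[x+z] = solve-∀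

  no-shorter-period : ∀ {c} → 0 < c → c < length u → ¬ Period c P
  no-shorter-period {suc c} _ c<u per
    with omegaPower-shorter {ℓ = reverse u} P-power per (subst (suc c ≤_) (sym (length-reverse u)) (<⇒≤ c<u))
  ... | a , as , pw , |as| = <⇒≱ c<u (subst (length u ≤_) (trans (length-reverse (a ∷ as)) (cong suc |as|))
                                            (proj₁ (minimal (reverse (a ∷ as)) w (leftUP-omegaPower {w = w} λw≗ pw))))

  period-divisible : ∀ {δ} .{{_ : NonZero (length u)}} → Period δ P → length u ∣ δ
  period-divisible {δ} per = m%n≡0⇒n∣m δ (length u) (short-period≡0 (m%n<n δ (length u)) (period-% P-period per))
    where
      short-period≡0 : ∀ {c} → c < length u → Period c P → c ≡ 0
      short-period≡0 {zero}  _   _   = refl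
      short-period≡0 {suc c} c<u per = ⊥-elim (no-shorter-period z<s c<u per)

  first-letter-differs : ∀ {m₀ p'} → length w ≡ suc m₀ → length u ≡ suc p' → λw m₀ ≢ λw (length u + m₀)
  first-letter-differs |w| |u| first≡ with ∷-of-length w |w| | ∷-of-length u |u|
  ... | cw , wt , refl , refl | cu , ut , refl , refl
    with leftUP-absorb-first-letter {cw = cw} {wt} {cu} {ut} λw≗ P-power
           (trans first≡ (trans (cong λw (cong suc (+-comm (length ut) (length wt)))) (λw-tail (length ut))))
  ...   | u' , up = 1+n≰n (proj₂ (minimal u' wt up))

module Rog {A : Set} {λw ρ : ℕ → A} {u w₁ w₂ v y z : List A} {P Q : ℕ → A}
  (P-power : IsOmegaPower (reverse u) P) (λw≗ : λw ≗ prepend (reverse w₁) P)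
  (minimal : ∀ u' w' → LeftUP λw u' w' → length u ≤ length u' × length w₁ ≤ length w')
  (Q-power : IsOmegaPower v Q) (ρ≗ : ρ ≗ prepend w₂ Q)
  (u≡yz : u ≡ y ++ z) (v≡zy : v ≡ z ++ y)
  .{{_ : NonZero (length u)}}
  where

  open CanonicalLeft {u = u} {w₁} P-power λw≗ minimal
  open ≡-Reasoning

  private
    m : ℕ
    m = length w₁
    m' : ℕ
    m' = length w₂
    p : ℕ
    p = length u
    Y : ℕ
    Y = length y
    Z : ℕ
    Z = length z

    p≡Y+Z : p ≡ Y + Z
    p≡Y+Z = trans (cong length u≡yz) (length-++ y)

  ρ-tail : ∀ k → ρ (m' + k) ≡ Q k
  ρ-tail k = trans (ρ≗ _) (prepend-+ w₂ Q k)

  Q-power-zy : IsOmegaPower (z ++ y) Q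
  Q-power-zy = subst (λ ℓ → IsOmegaPower ℓ Q) v≡zy Q-power

  Q-period : Period p Q
  Q-period = subst (λ q → Period q Q) (trans (length-++ z) (trans (+-comm Z Y) (sym p≡Y+Z)))
                   (omegaPower-period {ℓ = z ++ y} Q-power-zy)

  Q-rotate : ∀ k → Q (Z + k) ≡ prepend y Q k
  Q-rotate k = trans (Q-power-zy _) (trans (prepend-++ z y Q _) (prepend-+ z _ k))

  -- Shifting the period v = zy of ρ by |z| gives u = yz, whose reverse is the period of λ read leftwards.
  yQ-power : IsOmegaPower u (prepend y Q)
  yQ-power = subst (λ ℓ → IsOmegaPower ℓ (prepend y Q)) (sym u≡yz) (omegaPower-rotate {ℓ₁ = z} Q-power-zy)

  mirror-canonical : ∀ T → Mirror λw ρ m m' (m + m' + Z + T * p)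
  mirror-canonical T a b m≤a m'≤b e with m≤n⇒∃[o]m+o≡n m≤a | m≤n⇒∃[o]m+o≡n m'≤b
  ... | i , refl | k , refl = begin
    λw (m + i)             ≡⟨ λw-tail i ⟩
    P i                    ≡⟨ omegaPower-reverse-mirror u P-power yQ-power (suc T) sum ⟩
    prepend y Q (Y + k)    ≡⟨ Q-rotate (Y + k) ⟨
    Q (Z + (Y + k))        ≡⟨ cong Q (trans (sym (+-assoc Z Y k)) (cong (_+ k) (trans (+-comm Z Y) (sym p≡Y+Z)))) ⟩
    Q (p + k)              ≡⟨ Q-period k ⟩
    Q k                    ≡⟨ ρ-tail k ⟨
    ρ (m' + k)             ∎
    where
      sum : suc (i + (Y + k)) ≡ suc T * p
      sum = +-cancelˡ-≡ (m + m') _ _ (begin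
        m + m' + suc (i + (Y + k))      ≡⟨ lhs m m' i Y k ⟩
        suc (m + i + (m' + k)) + Y      ≡⟨ cong (_+ Y) e ⟩
        m + m' + Z + T * p + Y          ≡⟨ rhs m m' Z (T * p) Y ⟩
        m + m' + (Y + Z + T * p)        ≡⟨ cong (λ q → m + m' + (q + T * p)) p≡Y+Z ⟨
        m + m' + suc T * p              ∎)
        where
          lhs : ∀ m m' i Y k → m + m' + suc (i + (Y + k)) ≡ suc (m + i + (m' + k)) + Y
          lhs = solve-∀
          rhs : ∀ m m' Z X Y → m + m' + Z + X + Y ≡ m + m' + (Y + Z + X)
          rhs = solve-∀

  -- Two alignments of λ against ρ, shifted by δ, agree on a window of length p; hence δ is a period.
  shift-period : ∀ {r s δ A' B} → Mirror λw ρ r r s → Mirror λw ρ m m' (δ + s) →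
                 r ≤ m + A' → r ≤ B → m' ≤ B → m + A' + p + B ≤ s → Period δ P
  shift-period {r} {s} {δ} {A'} {B} mir can r≤m+A' r≤B m'≤B fits x =
    sym (period-window P-period (period-shift δ P-period) A' window x)
    where
      window : ∀ i → i < p → P (A' + i) ≡ P (δ + (A' + i))
      window i i<p with m≤n⇒∃[o]m+o≡n (≤-trans (+-monoˡ-≤ B (+-monoʳ-≤ (m + A') i<p)) fits)
      ... | e , fits≡ = begin
        P (A' + i)                ≡⟨ λw-tail (A' + i) ⟨
        λw (m + (A' + i))         ≡⟨ mir _ (B + e) r≤a (≤-trans r≤B (m≤m+n B e)) sum₁ ⟩
        ρ (B + e)                 ≡⟨ can _ (B + e) (m≤m+n m _) (≤-trans m'≤B (m≤m+n B e)) sum₂ ⟨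
        λw (m + (δ + (A' + i)))   ≡⟨ λw-tail _ ⟩
        P (δ + (A' + i))          ∎
        where
          r≤a : r ≤ m + (A' + i)
          r≤a = ≤-trans r≤m+A' (≤-trans (m≤m+n (m + A') i) (≤-reflexive (+-assoc m A' i)))
          sum₁ : suc (m + (A' + i) + (B + e)) ≡ s
          sum₁ = trans (ring₁ m A' i B e) fits≡
            where ring₁ : ∀ m A' i B e → suc (m + (A' + i) + (B + e)) ≡ m + A' + suc i + B + e
                  ring₁ = solve-∀
          sum₂ : suc (m + (δ + (A' + i)) + (B + e)) ≡ δ + s
          sum₂ = trans (ring₂ m δ A' i B e) (cong (δ +_) fits≡)
            where ring₂ : ∀ m δ A' i B e → suc (m + (δ + (A' + i)) + (B + e)) ≡ δ + (m + A' + suc i + B + e)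
                  ring₂ = solve-∀

  -- A shift by a positive multiple of p, starting inside w₁, would make the first letter of w₁
  -- equal to the letter p positions to its left.
  tail-conflict : ∀ {r s q} → Mirror λw ρ r r s → Mirror λw ρ m m' (suc q * p + s) → r < m → m + m' + r ≤ s → ⊥
  tail-conflict {r} {s} {q} mir can r<m fits with m≤n⇒∃[o]m+o≡n r<m | m≤n⇒∃[o]m+o≡n fits
  ... | e , m₀+1≡m | f , fits≡ = first-letter-differs (sym m₀+1≡m) (sym (suc-pred p)) (begin
    λw (r + e)                  ≡⟨ mir (r + e) b (m≤m+n r e) (≤-trans (m≤n+m r m') (m≤m+n (m' + r) f)) sum₁ ⟩
    ρ b                         ≡⟨ can _ b m≤shifted (≤-trans (m≤m+n m' r) (m≤m+n (m' + r) f)) sum₂ ⟨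
    λw (suc q * p + (r + e))    ≡⟨ cong λw (+-assoc p (q * p) (r + e)) ⟩
    λw (p + (q * p + (r + e)))  ≡⟨ cong λw (x+[y+z]≡y+[x+z] p (q * p) (r + e)) ⟩
    λw (q * p + (p + (r + e)))  ≡⟨ λw-period q m≤p+m₀ ⟩
    λw (p + (r + e))            ∎)
    where
      b = m' + r + f
      m≤p+m₀ : m ≤ p + (r + e)
      m≤p+m₀ = ≤-trans (≤-reflexive (sym m₀+1≡m)) (+-monoˡ-≤ (r + e) (>-nonZero⁻¹ p))
      m≤shifted : m ≤ suc q * p + (r + e)
      m≤shifted = ≤-trans m≤p+m₀ (+-monoˡ-≤ (r + e) (m≤m+n p (q * p)))
      sum₁ : suc (r + e + b) ≡ s
      sum₁ = trans (cong (_+ b) m₀+1≡m) (trans (x+[y+z+w]≡x+y+z+w m m' r f) fits≡)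
        where x+[y+z+w]≡x+y+z+w : ∀ x y z w → x + (y + z + w) ≡ x + y + z + w
              x+[y+z+w]≡x+y+z+w = solve-∀
      sum₂ : suc (suc q * p + (r + e) + b) ≡ suc q * p + s
      sum₂ = trans (+-suc-assoc (suc q * p) (r + e) b) (cong (suc q * p +_) sum₁)
        where +-suc-assoc : ∀ x y z → suc (x + y + z) ≡ x + suc (y + z)
              +-suc-assoc = solve-∀
      x+[y+z]≡y+[x+z] : ∀ x y z → x + (y + z) ≡ y + (x + z)
      x+[y+z]≡y+[x+z] = solve-∀

  shifted-alignment-impossible : ∀ {n r δ'} → m' ≤ m → r + suc δ' < m + p → r + p ≤ n → m + m' + p ≤ n →
                                 Mirror λw ρ r r (n + r) → Mirror λw ρ m m' (suc δ' + (n + r)) → ⊥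
  shifted-alignment-impossible {n} {r} {δ'} m'≤m r+δ<m+p r+p≤n m+m'+p≤n mir can with m ≤? r
  ... | yes m≤r with m≤n⇒∃[o]m+o≡n m≤r
  ...   | e , refl = no-shorter-period z<s (+-cancelˡ-< (m + e) _ _ (<-≤-trans r+δ<m+p (+-monoˡ-≤ p (m≤m+n m e))))
                       (shift-period {δ = suc δ'} mir can ≤-refl ≤-refl (≤-trans m'≤m (m≤m+n m e))
                                     (+-monoˡ-≤ (m + e) r+p≤n))
  shifted-alignment-impossible {n} {r} {δ'} m'≤m r+δ<m+p r+p≤n m+m'+p≤n mir can | no m≰r
    with period-divisible (shift-period {δ = suc δ'} {A' = 0} mir can
                             (≤-trans (<⇒≤ (≰⇒> m≰r)) (≤-reflexive (sym (+-identityʳ m))))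
                             (m≤n+m r m') (m≤m+n m' r) window-fits)
    where
      window-fits : m + 0 + p + (m' + r) ≤ n + r
      window-fits = subst (_≤ n + r) (sym (rearrange m m' p r)) (+-monoˡ-≤ r m+m'+p≤n)
        where rearrange : ∀ m m' p r → m + 0 + p + (m' + r) ≡ m + m' + p + r
              rearrange = solve-∀
  ... | divides (suc q) δ≡ = tail-conflict {q = q} mir (subst (λ d → Mirror λw ρ m m' (d + (n + r))) δ≡ can)
                                           (≰⇒> m≰r) (+-monoˡ-≤ r (≤-trans (m≤m+n (m + m') p) m+m'+p≤n))

  isRog : ∀ {n r₀ T} → m' ≤ m → m ≤ r₀ → r₀ < m + p → n + r₀ ≡ m + m' + Z + T * p →
          r₀ + p ≤ n → m + m' + p ≤ n → IsRog (suffixL λw n) (prefixR ρ n) r₀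
  isRog {n} {r₀} {T} m'≤m m≤r₀ r₀<m+p n+r₀≡ r₀+p≤n m+m'+p≤n = overlap-at-r₀ , overlap-at-most-r₀
    where
      canonical : Mirror λw ρ m m' (n + r₀)
      canonical = subst (Mirror λw ρ m m') (sym n+r₀≡) (mirror-canonical T)

      r₀≤n : r₀ ≤ n
      r₀≤n = ≤-trans (m≤m+n r₀ p) r₀+p≤n

      overlap-at-r₀ : Overlap (suffixL λw n) (prefixR ρ n) r₀
      overlap-at-r₀ = mirror⇒overlap λw ρ r₀≤n (mirror-mono m≤r₀ (≤-trans m'≤m m≤r₀) canonical)

      overlap-at-most-r₀ : ∀ r → Overlap (suffixL λw n) (prefixR ρ n) r → r₀ ≤ r
      overlap-at-most-r₀ r ov with r₀ ≤? r
      ... | yes r₀≤r = r₀≤r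
      ... | no r₀≰r with m≤n⇒∃[o]m+o≡n (≰⇒> r₀≰r)
      ...   | δ' , r+1+δ≡r₀ = ⊥-elim (shifted-alignment-impossible m'≤m (subst (_< m + p) (sym r+δ≡r₀) r₀<m+p)
                 (≤-trans (+-monoˡ-≤ p (≤-trans (m≤m+n r (suc δ')) (≤-reflexive r+δ≡r₀))) r₀+p≤n) m+m'+p≤n
                 (overlap⇒mirror λw ρ (≤-trans (<⇒≤ (≰⇒> r₀≰r)) r₀≤n) ov)
                 (subst (Mirror λw ρ m m') (trans (cong (n +_) (sym r+δ≡r₀)) (rearrange n r δ')) canonical))
        where r+δ≡r₀ : r + suc δ' ≡ r₀
              r+δ≡r₀ = trans (+-suc r δ') r+1+δ≡r₀
              rearrange : ∀ n r δ' → n + (r + suc δ') ≡ suc δ' + (n + r)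
              rearrange = solve-∀

m+[1+n]∸1≡m+n : ∀ m p' → m + suc p' ∸ 1 ≡ m + p'
m+[1+n]∸1≡m+n m p' = cong pred (+-suc m p')

j<n⇒m≤m+n∸1∸j : ∀ m {p j} → j < p → m ≤ m + p ∸ 1 ∸ j
j<n⇒m≤m+n∸1∸j m {suc p'} {j} (s≤s j≤p') rewrite m+[1+n]∸1≡m+n m p' =
  ≤-trans (m≤m+n m (p' ∸ j)) (≤-reflexive (sym (+-∸-assoc m j≤p')))

m+n∸1∸j<m+n : ∀ m {p} j → 0 < p → m + p ∸ 1 ∸ j < m + p
m+n∸1∸j<m+n m {suc p'} j _ rewrite m+[1+n]∸1≡m+n m p' = ≤-<-trans (m∸n≤m (m + p') j) (+-monoʳ-< m (n<1+n p'))

j<n⇒m+n∸1∸j+j≡m+n∸1 : ∀ m {p j} → j < p → m + p ∸ 1 ∸ j + j ≡ m + p ∸ 1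
j<n⇒m+n∸1∸j+j≡m+n∸1 m {suc p'} (s≤s j≤p') rewrite m+[1+n]∸1≡m+n m p' = m∸n+n≡m (≤-trans j≤p' (m≤n+m p' m))

rog-antidiagonal : ∀ m m' Z d k {mbar p j} → j < p → mbar ≡ m' + Z + d * p →
            mbar + 1 + j + p * k + (m + p ∸ 1 ∸ j) ≡ m + m' + Z + suc (d + k) * p
rog-antidiagonal m m' Z d k {p = suc p'} {j} j<p refl = begin
  m' + Z + d * suc p' + 1 + j + suc p' * k + r₀    ≡⟨ move-j (m' + Z + d * suc p') j (suc p' * k) r₀ ⟩
  m' + Z + d * suc p' + 1 + suc p' * k + (r₀ + j)  ≡⟨ cong (m' + Z + d * suc p' + 1 + suc p' * k +_)
                                                            (trans (j<n⇒m+n∸1∸j+j≡m+n∸1 m j<p) (m+[1+n]∸1≡m+n m p')) ⟩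
  m' + Z + d * suc p' + 1 + suc p' * k + (m + p')  ≡⟨ collect m m' Z d k p' ⟩
  m + m' + Z + suc (d + k) * suc p'                ∎
  where
    open ≡-Reasoning
    r₀ = m + suc p' ∸ 1 ∸ j
    move-j : ∀ X j Y r → X + 1 + j + Y + r ≡ X + 1 + Y + (r + j)
    move-j = solve-∀
    collect : ∀ m m' Z d k p' → m' + Z + d * suc p' + 1 + suc p' * k + (m + p') ≡ m + m' + Z + suc (d + k) * suc p'
    collect = solve-∀

rog-room : ∀ m {mbar k p} j → m + p ∸ 1 ≤ mbar → 1 ≤ k → m + p ∸ 1 ∸ j + p ≤ mbar + 1 + j + p * k
rog-room m {mbar} {k} {p} j M≤mbar 1≤k =
  ≤-trans (+-mono-≤ (≤-trans (m∸n≤m _ j) M≤mbar) (≤-trans (≤-reflexive (sym (*-identityʳ p))) (*-monoʳ-≤ p 1≤k)))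
          (+-monoˡ-≤ (p * k) (≤-trans (m≤m+n mbar 1) (m≤m+n (mbar + 1) j)))

rog-beyond-tails : ∀ m m' Z d {mbar k₀ k p} j → 0 < p → mbar ≡ m' + Z + d * p → m + p ∸ 1 < Z + (d + k₀) * p →
              k₀ ≤ k → m + m' + p ≤ mbar + 1 + j + p * k
rog-beyond-tails m m' Z d {k₀ = k₀} {k} {suc p'} j _ refl M<Z+[d+k₀]p k₀≤k = begin
  m + m' + suc p'                         ≡⟨ regroup m m' p' ⟩
  m' + suc (m + p')                       ≤⟨ +-monoʳ-≤ m' (subst (_< Z + (d + k₀) * suc p') (m+[1+n]∸1≡m+n m p') M<Z+[d+k₀]p) ⟩
  m' + (Z + (d + k₀) * suc p')            ≤⟨ +-monoʳ-≤ m' (+-monoʳ-≤ Z (*-monoˡ-≤ (suc p') (+-monoʳ-≤ d k₀≤k))) ⟩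
  m' + (Z + (d + k) * suc p')             ≤⟨ m≤m+n _ (1 + j) ⟩
  m' + (Z + (d + k) * suc p') + (1 + j)   ≡⟨ expand m' Z d k p' j ⟩
  m' + Z + d * suc p' + 1 + j + suc p' * k ∎
  where
    open ≤-Reasoning
    regroup : ∀ m m' p' → m + m' + suc p' ≡ m' + suc (m + p')
    regroup = solve-∀
    expand : ∀ m' Z d k p' j → m' + (Z + (d + k) * suc p') + (1 + j) ≡ m' + Z + d * suc p' + 1 + j + suc p' * k
    expand = solve-∀

proposition3p4 : (q : ℕ) → (λw ρ : ℕ → Fin (suc q)) → (u w₁ w₂ v y z : List (Fin (suc q))) →
    SamePeriodWords λw ρ →
    CanonicalL λw u w₁ → CanonicalR ρ w₂ v →
    u ≡ y ++ z → v ≡ z ++ y → y ≢ [] →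
    length w₂ ≤ length w₁ →
    (mbar d k₀ : ℕ) →
    length w₁ + length u ∸ 1 ≤ mbar →
    mbar ≤ length w₁ + length u ∸ 1 + (length u ∸ 1) →
    mbar ≡ length w₂ + length z + d * length u →
    1 ≤ k₀ →
    length w₁ + length u ∸ 1 < length z + (d + k₀) * length u →
    (∀ k → 1 ≤ k → length w₁ + length u ∸ 1 < length z + (d + k) * length u → k₀ ≤ k) →
    ∀ k j → k₀ ≤ k → j < length u →
    IsRog (suffixL λw (mbar + 1 + j + length u * k)) (prefixR ρ (mbar + 1 + j + length u * k))
    (length w₁ + length u ∸ 1 ∸ j)
proposition3p4 q λw ρ u w₁ w₂ v (c ∷ y') z _ ((a , as , ru≡ , λw≡) , minimal) ((b , bs , v≡ , ρ≡) , _)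
               u≡yz v≡zy _ w₂≤w₁ mbar d k₀ M≤mbar _ mbar≡ 1≤k₀ M<Z+[d+k₀]p _ k j k₀≤k j<p =
  isRog {T = suc (d + k)} w₂≤w₁ (j<n⇒m≤m+n∸1∸j m j<p) (m+n∸1∸j<m+n m j 0<p) (rog-antidiagonal m m' Z d k j<p mbar≡)
      (rog-room m j M≤mbar (≤-trans 1≤k₀ k₀≤k)) (rog-beyond-tails m m' Z d j 0<p mbar≡ M<Z+[d+k₀]p k₀≤k)
  where
    m = length w₁
    m' = length w₂
    Z = length z
    0<p : 0 < length u
    0<p = subst (0 <_) (sym (cong length u≡yz)) z<s
    open Rog {w₁ = w₁} {w₂} {y = c ∷ y'} {z}
             (omegaPower-cyc ru≡) (λ i → trans (λw≡ i) (rightWord-prepend (reverse w₁) a as i)) minimal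
             (omegaPower-cyc v≡) (λ i → trans (ρ≡ i) (rightWord-prepend w₂ b bs i)) u≡yz v≡zy {{>-nonZero 0<p}}
proposition3p4 q λw ρ u w₁ w₂ v [] z _ _ _ _ _ y≢[] = ⊥-elim (y≢[] refl)
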